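{- Let $U$ be a numeration system satisfying (H1), (H2) and (H3), and let $Z$ be the constant defined below. If $w$ is a greedy $U$-representation, then for all $z\ge Z$, the word $10^zw$ is also a greedy $U$-representation.
   Context: A numeration system is an increasing sequence $U=(U_i)_{i\ge0}$ of integers with $U_0=1$ such that $C_U=\sup_{i}\lceil U_{i+1}/U_i\rceil$ is finite; $A_U=\{0,\ldots,C_U-1\}$. For $n\ge1$, $\operatorname{rep}_U(n)=w_\ell\cdots w_0$ is the unique word over $A_U$ with $n=\sum w_iU_i$, $w_\ell\ne0$ and $\sum_{i=0}^t w_iU_i<U_{t+1}$ for $t=0,\ldots,\ell$; $\operatorname{rep}_U(0)$ is the empty word. A greedy $U$-representation is a word of the form $\operatorname{rep}_U(n)$. (H1): $\operatorname{rep}_U(\mathbb{N})$ is regular. (H2): $\limsup_{i}(U_{i+1}-U_i)=+\infty$. (H3): there is $G\ge0$ with $U_{i+1}-U_i\le U_{i+2}-U_{i+1}$ for all $i\ge G$ (fix such a $G$). Constant $Z$: fix an integer $C>0$ such that for every greedy $U$-representation $w$ there is $\ell<C$ with $10^\ell w$ a greedy $U$-representation (such $C$ exists under (H1),(H2)); let $R$ be the least integer with $R\ge G$ and $U_{R+1}-U_R\ge U_{i+1}-U_i$ for all $i\le R$ (it exists by (H2)); set $Z=\max\{R,C\}$. -}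

module Defs where

open import Data.Nat using (ℕ; zero; suc; _+_; _*_; _∸_; _≤_; _<_; _≥_; _⊔_)
open import Data.Fin using (Fin)
open import Data.Bool using (Bool; true)
open import Data.List using (List; []; _∷_; reverse; take; length; replicate; _++_; foldl)
open import Data.List.Relation.Unary.All using (All)
open import Data.Product using (Σ; ∃; ∃-syntax; _×_)
open import Data.Sum using (_⊎_)
open import Relation.Binary.PropositionalEquality using (_≡_; _≢_)
open import Function.Bundles using (_⇔_)

-- A word is a list of digits, written most significant digit first:
-- the list  w_ℓ ∷ … ∷ w_0 ∷ []  represents  w_ℓ ⋯ w_0.
Word : Set
Word = List ℕ

-- A numeration system: U 0 = 1, U strictly increasing, and
-- C_U = sup_i ⌈U_{i+1}/U_i⌉ finite, i.e. ∃ K, ∀ i, U_{i+1} ≤ K * U_i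
-- (since ⌈a/b⌉ ≤ K ⇔ a ≤ K * b for b > 0).
record IsNumerationSystem (U : ℕ → ℕ) : Set where
  field
    U0≡1       : U 0 ≡ 1
    increasing : ∀ i → U i < U (suc i)
    C-finite   : ∃[ K ] (∀ i → U (suc i) ≤ K * U i)

-- Membership in the alphabet A_U = {0,…,C_U-1}:
-- d < C_U  ⇔  ∃ i, d < ⌈U_{i+1}/U_i⌉  ⇔  ∃ i, d * U_i < U_{i+1}.
InAlphabet : (ℕ → ℕ) → ℕ → Set
InAlphabet U d = ∃[ i ] (d * U i < U (suc i))

-- valAt U i (d_0 ∷ d_1 ∷ …) = Σ_j d_j U_{i+j}  (least significant digit first)
valAt : (ℕ → ℕ) → ℕ → List ℕ → ℕ
valAt U i []       = 0
valAt U i (d ∷ ds) = d * U i + valAt U (suc i) ds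

val : (ℕ → ℕ) → Word → ℕ
val U w = valAt U 0 (reverse w)

LeadingNonzero : Word → Set
LeadingNonzero []      = Data.Unit.⊤
  where import Data.Unit
LeadingNonzero (d ∷ _) = d ≢ 0

-- IsRep U n w : w = rep_U(n), i.e. w is a word over A_U with value n,
-- nonzero leading digit, and Σ_{i=0}^t w_i U_i < U_{t+1} for t = 0,…,ℓ.
IsRep : (ℕ → ℕ) → ℕ → Word → Set
IsRep U n w =
  All (InAlphabet U) w ×
  LeadingNonzero w ×
  val U w ≡ n ×
  (∀ t → t < length w → valAt U 0 (take (suc t) (reverse w)) < U (suc t))

IsGreedyRep : (ℕ → ℕ) → Word → Set
IsGreedyRep U w = ∃[ n ] IsRep U n w

record DFA : Set where
  field
    states : ℕ
    start  : Fin states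
    δ      : Fin states → ℕ → Fin states
    accept : Fin states → Bool

run : (A : DFA) → Fin (DFA.states A) → Word → Fin (DFA.states A)
run A q []       = q
run A q (a ∷ as) = run A (DFA.δ A q a) as

Accepts : DFA → Word → Set
Accepts A w = DFA.accept A (run A (DFA.start A) w) ≡ true

Regular : (Word → Set) → Set
Regular L = ∃[ A ] (∀ w → L w ⇔ Accepts A w)

H1 : (ℕ → ℕ) → Set
H1 U = Regular (IsGreedyRep U)

-- (H2)  limsup (U_{i+1} - U_i) = +∞
H2 : (ℕ → ℕ) → Set
H2 U = ∀ M N → ∃[ i ] (N ≤ i × M ≤ U (suc i) ∸ U i)

H3With : (ℕ → ℕ) → ℕ → Set
H3With U G = ∀ i → G ≤ i → U (suc i) ∸ U i ≤ U (suc (suc i)) ∸ U (suc i)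

10^_·_ : ℕ → Word → Word
10^ ℓ · w = 1 ∷ (replicate ℓ 0 ++ w)

AdmissibleC : (ℕ → ℕ) → ℕ → Set
AdmissibleC U C = 0 < C × (∀ w → IsGreedyRep U w → ∃[ ℓ ] (ℓ < C × IsGreedyRep U (10^ ℓ · w)))

RProp : (ℕ → ℕ) → ℕ → ℕ → Set
RProp U G R = G ≤ R × (∀ i → i ≤ R → U (suc i) ∸ U i ≤ U (suc R) ∸ U R)

IsR : (ℕ → ℕ) → ℕ → ℕ → Set
IsR U G R = RProp U G R × (∀ R' → RProp U G R' → R ≤ R')

-- Write d_i = U_{i+1} − U_i and let w = rep_U(n) have length L. Below its leading digit
-- the prefix values of 1 0^k w are those of w or n itself, and n < U_L, so 1 0^k w is greedy
-- exactly when n + U_{L+k} < U_{L+k+1}, i.e. when n < d_{L+k}. Admissibility of C gives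
-- some ℓ < C with n < d_{L+ℓ}, and d_{L+ℓ} ≤ d_{L+z} whenever z ≥ max(R, C): by (H3) when
-- L + ℓ ≥ G, and because d_R dominates every earlier difference when L + ℓ < G ≤ R.
module Submission where

open import Defs
open import Data.Nat using (ℕ; _≤_; _⊔_; zero; suc; _+_; _*_; _∸_; _<_; z≤n; s≤s; _≤′_; ≤′-refl; ≤′-step)
open import Data.Nat.Properties
open import Data.List using (List; []; _∷_; [_]; reverse; take; length; replicate; _++_; _∷ʳ_)
open import Data.List.Properties using (length-++; length-replicate; length-reverse; reverse-++; unfold-reverse; take-all)
open import Data.List.Relation.Unary.All using (All; _∷_)
open import Data.List.Relation.Unary.All.Properties using (++⁺; replicate⁺)
open import Data.Product using (_,_)
open import Function.Bundles using (_⇔_; mk⇔; Equivalence)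
open import Relation.Binary.PropositionalEquality using (_≡_; refl; sym; trans; cong; subst; module ≡-Reasoning)
open import Relation.Nullary using (yes; no)

private
  variable
    A : Set

take-++ˡ : ∀ n (r s : List A) → n ≤ length r → take n (r ++ s) ≡ take n r
take-++ˡ zero    r       s _         = refl
take-++ˡ (suc n) (x ∷ r) s (s≤s n≤r) = cong (x ∷_) (take-++ˡ n r s n≤r)

take-++ʳ : ∀ n (r s : List A) → take (length r + n) (r ++ s) ≡ r ++ take n s
take-++ʳ n []      s = refl
take-++ʳ n (x ∷ r) s = cong (x ∷_) (take-++ʳ n r s)

replicate-∷ʳ : ∀ k (x : A) → replicate k x ∷ʳ x ≡ x ∷ replicate k x
replicate-∷ʳ zero    x = refl
replicate-∷ʳ (suc k) x = cong (x ∷_) (replicate-∷ʳ k x)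

reverse-replicate : ∀ k (x : A) → reverse (replicate k x) ≡ replicate k x
reverse-replicate zero    x = refl
reverse-replicate (suc k) x = begin
  reverse (x ∷ replicate k x) ≡⟨ unfold-reverse x (replicate k x) ⟩
  reverse (replicate k x) ∷ʳ x ≡⟨ cong (_∷ʳ x) (reverse-replicate k x) ⟩
  replicate k x ∷ʳ x           ≡⟨ replicate-∷ʳ k x ⟩
  x ∷ replicate k x            ∎
  where open ≡-Reasoning

reverse-10^ : ∀ k w → reverse (10^ k · w) ≡ reverse w ++ replicate k 0 ++ [ 1 ]
reverse-10^ k w = begin
  reverse (1 ∷ replicate k 0 ++ w)                ≡⟨ reverse-++ (1 ∷ replicate k 0) w ⟩
  reverse w ++ reverse (1 ∷ replicate k 0)        ≡⟨ cong (reverse w ++_) (unfold-reverse 1 (replicate k 0)) ⟩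
  reverse w ++ (reverse (replicate k 0) ∷ʳ 1)     ≡⟨ cong (λ z → reverse w ++ (z ∷ʳ 1)) (reverse-replicate k 0) ⟩
  reverse w ++ replicate k 0 ++ [ 1 ]             ∎
  where open ≡-Reasoning

length-zeros-one : ∀ k → length (replicate k 0 ++ [ 1 ]) ≡ suc k
length-zeros-one k = trans (length-++ (replicate k 0)) (trans (cong (_+ 1) (length-replicate k)) (+-comm k 1))

mono-from : (f : ℕ → ℕ) {a : ℕ} → (∀ i → a ≤ i → f i ≤ f (suc i)) →
            ∀ {i j} → a ≤ i → i ≤ j → f i ≤ f j
mono-from f {a} step {i} a≤i i≤j = go (≤⇒≤′ i≤j)
  where
  go : ∀ {j} → i ≤′ j → f i ≤ f j
  go ≤′-refl        = ≤-refl
  go (≤′-step i≤′j) = ≤-trans (go i≤′j) (step _ (≤-trans a≤i (≤′⇒≤ i≤′j)))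

gap : (ℕ → ℕ) → ℕ → ℕ
gap U i = U (suc i) ∸ U i

+<-suc⇒<gap : ∀ (U : ℕ → ℕ) n i → n + U i < U (suc i) → n < gap U i
+<-suc⇒<gap U n i = m+n≤o⇒m≤o∸n (suc n)

<gap⇒+<-suc : ∀ (U : ℕ → ℕ) n i → U i ≤ U (suc i) → n < gap U i → n + U i < U (suc i)
<gap⇒+<-suc U n i = m≤o∸n⇒m+n≤o (suc n)

gap-mono : ∀ U {G R i j} → RProp U G R → H3With U G → i ≤ j → R ≤ j → gap U i ≤ gap U j
gap-mono U {G} {R} {i} (G≤R , gap≤gapR) h3 i≤j R≤j with G ≤? i
... | yes G≤i = mono-from (gap U) h3 G≤i i≤j
... | no  G≰i = ≤-trans (gap≤gapR i (≤-trans (<⇒≤ (≰⇒> G≰i)) G≤R)) (mono-from (gap U) h3 G≤R R≤j)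

module _ (U : ℕ → ℕ) where

  valAt-++ : ∀ i r s → valAt U i (r ++ s) ≡ valAt U i r + valAt U (i + length r) s
  valAt-++ i []      s = cong (λ j → valAt U j s) (sym (+-identityʳ i))
  valAt-++ i (x ∷ r) s = begin
    x * U i + valAt U (suc i) (r ++ s)                           ≡⟨ cong (x * U i +_) (valAt-++ (suc i) r s) ⟩
    x * U i + (valAt U (suc i) r + valAt U (suc i + length r) s) ≡⟨ +-assoc (x * U i) _ _ ⟨
    x * U i + valAt U (suc i) r + valAt U (suc i + length r) s   ≡⟨ cong (λ j → x * U i + valAt U (suc i) r + valAt U j s) (+-suc i (length r)) ⟨
    x * U i + valAt U (suc i) r + valAt U (i + suc (length r)) s ∎
    where open ≡-Reasoning

  valAt-take-zeros-one-< : ∀ j {m k} → m < k → valAt U j (take (suc m) (replicate k 0 ++ [ 1 ])) ≡ 0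
  valAt-take-zeros-one-< j {zero}  {suc k} _         = refl
  valAt-take-zeros-one-< j {suc m} {suc k} (s≤s m<k) = valAt-take-zeros-one-< (suc j) m<k

  valAt-take-zeros-one : ∀ j k → valAt U j (take (suc k) (replicate k 0 ++ [ 1 ])) ≡ U (j + k)
  valAt-take-zeros-one j zero    = trans (+-identityʳ _) (trans (+-identityʳ _) (cong U (sym (+-identityʳ j))))
  valAt-take-zeros-one j (suc k) = trans (valAt-take-zeros-one (suc j) k) (cong U (sym (+-suc j k)))

  Greedy : List ℕ → Set
  Greedy r = ∀ t → t < length r → valAt U 0 (take (suc t) r) < U (suc t)

  IsRep⇒Greedy : ∀ {n w} → IsRep U n w → Greedy (reverse w)
  IsRep⇒Greedy {w = w} (_ , _ , _ , greedy) t t<r = greedy t (subst (t <_) (length-reverse w) t<r)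

  Greedy⇒IsRep-greedy : ∀ w → Greedy (reverse w) →
    ∀ t → t < length w → valAt U 0 (take (suc t) (reverse w)) < U (suc t)
  Greedy⇒IsRep-greedy w greedy t t<w = greedy t (subst (t <_) (sym (length-reverse w)) t<w)

  GreedyAfter : List ℕ → List ℕ → Set
  GreedyAfter r s = ∀ m → m < length s →
    valAt U 0 r + valAt U (length r) (take (suc m) s) < U (suc (length r + m))

  valAt-take-++ʳ : ∀ m r s → valAt U 0 (take (suc (length r + m)) (r ++ s)) ≡
                             valAt U 0 r + valAt U (length r) (take (suc m) s)
  valAt-take-++ʳ m r s = begin
    valAt U 0 (take (suc (length r + m)) (r ++ s)) ≡⟨ cong (λ n → valAt U 0 (take n (r ++ s))) (+-suc (length r) m) ⟨
    valAt U 0 (take (length r + suc m) (r ++ s))   ≡⟨ cong (valAt U 0) (take-++ʳ (suc m) r s) ⟩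
    valAt U 0 (r ++ take (suc m) s)                ≡⟨ valAt-++ 0 r (take (suc m) s) ⟩
    valAt U 0 r + valAt U (length r) (take (suc m) s) ∎
    where open ≡-Reasoning

  Greedy-++⁻ʳ : ∀ r s → Greedy (r ++ s) → GreedyAfter r s
  Greedy-++⁻ʳ r s greedy m m<s = subst (_< U (suc (length r + m))) (valAt-take-++ʳ m r s)
    (greedy (length r + m) (subst (length r + m <_) (sym (length-++ r)) (+-monoʳ-< (length r) m<s)))

  Greedy-++⁺ : ∀ r s → Greedy r → GreedyAfter r s → Greedy (r ++ s)
  Greedy-++⁺ r s greedy after t t<rs with t <? length r
  ... | yes t<r = subst (λ p → valAt U 0 p < U (suc t)) (sym (take-++ˡ (suc t) r s t<r)) (greedy t t<r)
  ... | no  t≮r with m≤n⇒∃[o]m+o≡n (≮⇒≥ t≮r)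
  ... | m , refl = subst (_< U (suc (length r + m))) (sym (valAt-take-++ʳ m r s))
    (after m (+-cancelˡ-< (length r) m _ (subst (length r + m <_) (length-++ r) t<rs)))

  module _ (NS : IsNumerationSystem U) where
    open IsNumerationSystem NS

    U-mono : ∀ {i j} → i ≤ j → U i ≤ U j
    U-mono = mono-from U (λ i _ → <⇒≤ (increasing i)) z≤n

    Greedy⇒valAt< : ∀ r → Greedy r → valAt U 0 r < U (length r)
    Greedy⇒valAt< []      _      = ≤-reflexive (sym U0≡1)
    Greedy⇒valAt< (x ∷ r) greedy =
      subst (λ p → valAt U 0 p < U (length (x ∷ r))) (take-all (length (x ∷ r)) (x ∷ r) ≤-refl)
        (greedy (length r) ≤-refl)

    GreedyAfter-zeros-one⇔ : ∀ r k → valAt U 0 r < U (length r) →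
      GreedyAfter r (replicate k 0 ++ [ 1 ]) ⇔ valAt U 0 r + U (length r + k) < U (suc (length r + k))
    GreedyAfter-zeros-one⇔ r k r<U = mk⇔ top after
      where
      k<length : k < length (replicate k 0 ++ [ 1 ])
      k<length = ≤-reflexive (sym (length-zeros-one k))

      top : GreedyAfter r (replicate k 0 ++ [ 1 ]) → valAt U 0 r + U (length r + k) < U (suc (length r + k))
      top after = subst (λ v → valAt U 0 r + v < U (suc (length r + k)))
        (valAt-take-zeros-one (length r) k) (after k k<length)

      after : valAt U 0 r + U (length r + k) < U (suc (length r + k)) → GreedyAfter r (replicate k 0 ++ [ 1 ])
      after top-ok m m<length with m <? k
      ... | yes m<k rewrite valAt-take-zeros-one-< (length r) m<k | +-identityʳ (valAt U 0 r) =
        <-≤-trans r<U (U-mono (m≤n⇒m≤1+n (m≤m+n (length r) m)))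
      ... | no  m≮k rewrite ≤-antisym (m<1+n⇒m≤n (subst (m <_) (length-zeros-one k) m<length)) (≮⇒≥ m≮k)
                          | valAt-take-zeros-one (length r) k = top-ok

    InAlphabet-0 : InAlphabet U 0
    InAlphabet-0 = 0 , ≤-<-trans z≤n (increasing 0)

    InAlphabet-1 : InAlphabet U 1
    InAlphabet-1 = 0 , subst (_< U 1) (sym (+-identityʳ (U 0))) (increasing 0)

    10^-greedy⇔ : ∀ {n w} k → IsRep U n w → IsGreedyRep U (10^ k · w) ⇔ n < gap U (length w + k)
    10^-greedy⇔ {w = w} k w-rep@(w-digits , _ , refl , _) = mk⇔ to from
      where
      r : List ℕ
      r = reverse w
      w-greedy : Greedy r
      w-greedy = IsRep⇒Greedy w-rep
      zeros-one : List ℕ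
      zeros-one = replicate k 0 ++ [ 1 ]
      bounded : GreedyAfter r zeros-one ⇔ valAt U 0 r + U (length r + k) < U (suc (length r + k))
      bounded = GreedyAfter-zeros-one⇔ r k (Greedy⇒valAt< r w-greedy)
      L≡ : length r ≡ length w
      L≡ = length-reverse w

      to : IsGreedyRep U (10^ k · w) → valAt U 0 r < gap U (length w + k)
      to (_ , rep) = subst (λ L → valAt U 0 r < gap U (L + k)) L≡
        (+<-suc⇒<gap U _ _ (Equivalence.to bounded
          (Greedy-++⁻ʳ r zeros-one (subst Greedy (reverse-10^ k w) (IsRep⇒Greedy rep)))))

      from : valAt U 0 r < gap U (length w + k) → IsGreedyRep U (10^ k · w)
      from n<gap = val U (10^ k · w) , digits , (λ ()) , refl ,
        Greedy⇒IsRep-greedy (10^ k · w) (subst Greedy (sym (reverse-10^ k w)) greedy)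
        where
        digits : All (InAlphabet U) (10^ k · w)
        digits = InAlphabet-1 ∷ ++⁺ (replicate⁺ k InAlphabet-0) w-digits
        greedy : Greedy (r ++ zeros-one)
        greedy = Greedy-++⁺ r zeros-one w-greedy (Equivalence.from bounded
          (<gap⇒+<-suc U _ _ (<⇒≤ (increasing _)) (subst (λ L → valAt U 0 r < gap U (L + k)) (sym L≡) n<gap)))

-- (H1) and (H2) only guarantee that C and R exist; here both are given.
lemma3p5 : (U : ℕ → ℕ) → IsNumerationSystem U → H1 U → H2 U →
    (G : ℕ) → H3With U G →
    (C : ℕ) → AdmissibleC U C →
    (R : ℕ) → IsR U G R →
    (w : Word) → IsGreedyRep U w →
    (z : ℕ) → R ⊔ C ≤ z → IsGreedyRep U (10^ z · w)
lemma3p5 U NS _ _ G h3 C (_ , admissible) R (R-prop , _) w w-greedy@(n , w-rep) z R⊔C≤z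
  with admissible w w-greedy
... | ℓ , ℓ<C , 10^ℓw-greedy =
  Equivalence.from (10^-greedy⇔ U NS z w-rep) (<-≤-trans n<gap[L+ℓ] gap[L+ℓ]≤gap[L+z])
  where
  L : ℕ
  L = length w
  n<gap[L+ℓ] : n < gap U (L + ℓ)
  n<gap[L+ℓ] = Equivalence.to (10^-greedy⇔ U NS ℓ w-rep) 10^ℓw-greedy
  gap[L+ℓ]≤gap[L+z] : gap U (L + ℓ) ≤ gap U (L + z)
  gap[L+ℓ]≤gap[L+z] = gap-mono U R-prop h3
    (+-monoʳ-≤ L (≤-trans (<⇒≤ ℓ<C) (≤-trans (m≤n⊔m R C) R⊔C≤z)))
    (≤-trans (≤-trans (m≤m⊔n R C) R⊔C≤z) (m≤n+m z L))
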